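{- Let $G$ be a group of order $4p$, where $p$ is a prime, let $H$ be a nontrivial subgroup of $G$, and let $x\in G$. If $HxH\neq Hx^{ -1}H$, then for any integer $0\leqslant b\leqslant |H|$, there exist $b$ pairwise disjoint right transversals of $H$ in $HxH\cup Hx^{ -1}H$ whose union is inverse-closed.
   Context: $HxH=\{hxh':h,h'\in H\}$ is a double coset; it is a union of right cosets of $H$. For a set $K$ of elements of $G$ that is a union of right cosets of $H$, a right transversal of $H$ in $K$ is a subset of $G$ formed by taking exactly one element from each right coset of $H$ contained in $K$. A subset $R$ is inverse-closed if $R^{ -1}=R$. -}

module Defs where

open import Data.Nat using (ℕ)
open import Data.Fin using (Fin)
open import Data.Fin.Subset using (Subset; _∈_; _∉_)
open import Data.Product using (Σ; ∃; _×_; _,_)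
open import Data.Sum using (_⊎_)
open import Relation.Nullary using (¬_)
open import Relation.Binary.PropositionalEquality using (_≡_; _≢_)
open import Algebra.Core using (Op₁; Op₂)
open import Algebra.Structures using (IsGroup)
open import Function.Bundles using (_⇔_)

-- A finite group of order n: WLOG its underlying set is Fin n
-- (every group of order n is isomorphic to one on Fin n), with
-- propositional equality as the group equality.
record FinGroup (n : ℕ) : Set where
  field
    _∙_     : Op₂ (Fin n)
    ε       : Fin n
    _⁻¹     : Op₁ (Fin n)
    isGroup : IsGroup _≡_ _∙_ ε _⁻¹
  infixl 7 _∙_
  infix  8 _⁻¹

module _ {n : ℕ} (G : FinGroup n) where
  open FinGroup G

  record IsSubgroup (H : Subset n) : Set where
    field
      ε∈H   : ε ∈ H
      ∙-closed : ∀ {a b} → a ∈ H → b ∈ H → (a ∙ b) ∈ H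
      ⁻¹-closed : ∀ {a} → a ∈ H → (a ⁻¹) ∈ H

  NontrivialSet : Subset n → Set
  NontrivialSet H = ∃ λ h → h ∈ H × h ≢ ε

  DoubleCoset : Subset n → Fin n → Fin n → Set
  DoubleCoset H x y = ∃ λ h → ∃ λ h′ → h ∈ H × h′ ∈ H × y ≡ h ∙ x ∙ h′

  InRightCoset : Subset n → Fin n → Fin n → Set
  InRightCoset H z y = ∃ λ h → h ∈ H × y ≡ h ∙ z

  record IsRightTransversal (H : Subset n) (K : Fin n → Set) (T : Subset n) : Set where
    field
      T⊆K      : ∀ {t} → t ∈ T → K t
      covers   : ∀ {y} → K y → ∃ λ t → t ∈ T × InRightCoset H y t
      unique   : ∀ {t t′} → t ∈ T → t′ ∈ T → InRightCoset H t t′ → t ≡ t′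

  InverseClosed : (Fin n → Set) → Set
  InverseClosed R = ∀ g → R g ⇔ R (g ⁻¹)

SameSet : ∀ {n} → (Fin n → Set) → (Fin n → Set) → Set
SameSet A B = ∀ g → A g ⇔ B g

_∪ₚ_ : ∀ {n} → (Fin n → Set) → (Fin n → Set) → (Fin n → Set)
(A ∪ₚ B) g = A g ⊎ B g

⋃ : ∀ {n b} → (Fin b → Subset n) → (Fin n → Set)
⋃ T g = ∃ λ i → g ∈ T i

module Submission where

-- Write E = HxH. Its right cosets are Hxv (v ∈ H) and its left cosets are uxH (u ∈ H); choosing
-- the least such u or v for each coset gives representatives u₀ … u_{m-1} and v₀ … v_{m-1}, where
-- m|K| = |H| for K = {k ∈ H : kx ∈ xH} (Lagrange; counting right cosets instead gives the same m,
-- as the stabiliser of Hx is the conjugate x⁻¹Kx). Every element of E is u_i k x v_j for exactly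
-- one (i, j, k), so for δ < m and k ∈ K the cyclic diagonal {u_i k x v_j : i + j ≡ δ (mod m)}
-- meets every left and every right coset of H in E exactly once, and these |H| diagonals are
-- pairwise disjoint. As HxH ≠ Hx⁻¹H, the double cosets E and E⁻¹ = Hx⁻¹H are disjoint, so each
-- diagonal A gives the right transversal A ∪ A⁻¹ of E ∪ E⁻¹; these are pairwise disjoint and
-- their union is inverse-closed.

open import Defs
open import Algebra.Bundles using (Group)
import Algebra.Construct.Flip.Op as Flip
import Algebra.Properties.Group as GroupProperties
open import Algebra.Structures using (IsGroup)
open import Data.Bool.Properties using (T-≡)
open import Data.Empty using (⊥; ⊥-elim)
open import Data.Fin using (Fin; zero; suc; toℕ; fromℕ<; inject; inject≤; cast; combine; remQuot)
open import Data.Fin.Properties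
  using (suc-injective; injective⇒≤; ¬∀⟶∃¬-smallest; toℕ-inject; toℕ-fromℕ<; toℕ-injective; toℕ<n;
         ≤-antisym; _≤?_; _≟_; all?; any?; nonZeroIndex; cast-involutive; combine-injective;
         combine-remQuot; inject≤-injective)
open import Data.Fin.Subset using (Subset; _∈_; _⊆_; ∣_∣; Empty; _∩_; inside; outside)
open import Data.Fin.Subset.Properties using (_∈?_; x∈p∩q⁻; x∈p∩q⁺)
open import Data.Nat as ℕ using (ℕ; _+_; _*_; _∸_; _%_; _≤_; NonZero)
open import Data.Nat.DivMod using (%-distribˡ-+; m%n%n≡m%n; [m+n]%n≡m%n; m<n⇒m%n≡m; m%n<n)
open import Data.Nat.Primality using (Prime)
import Data.Nat.Properties as ℕₚ
open import Data.Product using (∃; ∃₂; _×_; _,_; proj₁; proj₂; uncurry)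
open import Data.Sum using (_⊎_; inj₁; inj₂)
open import Data.Vec using (_∷_; tabulate; here; there)
open import Data.Vec.Properties using (lookup∘tabulate; lookup⇒[]=; []=⇒lookup)
open import Function using (_∘_; flip; Equivalence; mk⇔)
open import Level using (0ℓ)
open import Relation.Binary using (Rel; Decidable; IsEquivalence; Setoid)
open import Relation.Binary.PropositionalEquality
import Relation.Binary.Reasoning.Setoid as SetoidReasoning
open import Relation.Nullary using (Dec; isYes; ¬_)
open import Relation.Nullary.Decidable
  using (toWitness; fromWitness; decidable-stable; ¬?; _×-dec_; _⊎-dec_; _→-dec_)
open import Relation.Unary using (Pred)

module _ {n : ℕ} {P : Pred (Fin n) 0ℓ} (P? : ∀ x → Dec (P x)) where

  subset : Subset n
  subset = tabulate (isYes ∘ P?)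

  ∈-subset⁺ : ∀ {x} → P x → x ∈ subset
  ∈-subset⁺ {x} px = lookup⇒[]= x _ (trans (lookup∘tabulate _ x) (Equivalence.to T-≡ (fromWitness px)))

  ∈-subset⁻ : ∀ {x} → x ∈ subset → P x
  ∈-subset⁻ {x} x∈ =
    toWitness {a? = P? x} (Equivalence.from T-≡ (trans (sym (lookup∘tabulate _ x)) ([]=⇒lookup x∈)))

enum : ∀ {n} (p : Subset n) → Fin ∣ p ∣ → Fin n
enum (inside  ∷ p) zero    = zero
enum (inside  ∷ p) (suc i) = suc (enum p i)
enum (outside ∷ p) i       = suc (enum p i)

enum-∈ : ∀ {n} (p : Subset n) i → enum p i ∈ p
enum-∈ (inside  ∷ p) zero    = here
enum-∈ (inside  ∷ p) (suc i) = there (enum-∈ p i)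
enum-∈ (outside ∷ p) i       = there (enum-∈ p i)

enum-injective : ∀ {n} (p : Subset n) {i j} → enum p i ≡ enum p j → i ≡ j
enum-injective (inside  ∷ p) {zero}  {zero}  _  = refl
enum-injective (inside  ∷ p) {suc i} {suc j} eq = cong suc (enum-injective p (suc-injective eq))
enum-injective (outside ∷ p)                 eq = enum-injective p (suc-injective eq)

index : ∀ {n} (p : Subset n) {x} → x ∈ p → Fin ∣ p ∣
index (inside  ∷ p) here       = zero
index (inside  ∷ p) (there x∈) = suc (index p x∈)
index (outside ∷ p) (there x∈) = index p x∈

enum-index : ∀ {n} (p : Subset n) {x} (x∈p : x ∈ p) → enum p (index p x∈p) ≡ x
enum-index (inside  ∷ p) here       = refl
enum-index (inside  ∷ p) (there x∈) = cong suc (enum-index p x∈)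
enum-index (outside ∷ p) (there x∈) = cong suc (enum-index p x∈)

∣∣-≤-injection : ∀ {n} {p q : Subset n} (f : Fin n → Fin n) →
                 (∀ {x y} → f x ≡ f y → x ≡ y) → (∀ {x} → x ∈ p → f x ∈ q) → ∣ p ∣ ≤ ∣ q ∣
∣∣-≤-injection {p = p} {q} f f-injective f-maps = injective⇒≤ {f = g} g-injective
  where
  g : Fin ∣ p ∣ → Fin ∣ q ∣
  g i = index q (f-maps (enum-∈ p i))

  g-injective : ∀ {i j} → g i ≡ g j → i ≡ j
  g-injective {i} {j} eq = enum-injective p (f-injective (begin
    f (enum p i)  ≡⟨ enum-index q _ ⟨
    enum q (g i)  ≡⟨ cong (enum q) eq ⟩
    enum q (g j)  ≡⟨ enum-index q _ ⟩
    f (enum p j)  ∎))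
    where open ≡-Reasoning

∣∣-≡-bijection : ∀ {n} {p q : Subset n} (f g : Fin n → Fin n) →
                 (∀ x → g (f x) ≡ x) → (∀ x → f (g x) ≡ x) →
                 (∀ {x} → x ∈ p → f x ∈ q) → (∀ {x} → x ∈ q → g x ∈ p) → ∣ p ∣ ≡ ∣ q ∣
∣∣-≡-bijection f g g∘f f∘g f-maps g-maps = ℕₚ.≤-antisym
  (∣∣-≤-injection f (λ eq → trans (sym (g∘f _)) (trans (cong g eq) (g∘f _))) f-maps)
  (∣∣-≤-injection g (λ eq → trans (sym (f∘g _)) (trans (cong f eq) (f∘g _))) g-maps)

remQuot-injective : ∀ {m} n {q q′ : Fin (m * n)} → remQuot {m} n q ≡ remQuot n q′ → q ≡ q′
remQuot-injective {m} n {q} {q′} eq =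
  trans (sym (combine-remQuot {m} n q)) (trans (cong (uncurry combine) eq) (combine-remQuot {m} n q′))

pairs-injective⇒≤ : ∀ {m n p} (f : Fin m → Fin n → Fin p) →
                    (∀ {i j i′ j′} → f i j ≡ f i′ j′ → i ≡ i′ × j ≡ j′) → m * n ≤ p
pairs-injective⇒≤ {n = n} f f-injective = injective⇒≤ {f = uncurry f ∘ remQuot n} λ eq →
  let i≡i′ , j≡j′ = f-injective eq in remQuot-injective n (cong₂ _,_ i≡i′ j≡j′)

injective⇒≤-pairs : ∀ {m n p} (f : Fin p → Fin m × Fin n) →
                    (∀ {q q′} → f q ≡ f q′ → q ≡ q′) → p ≤ m * n
injective⇒≤-pairs f f-injective = injective⇒≤ {f = uncurry combine ∘ f} λ eq →
  let i≡i′ , j≡j′ = combine-injective _ _ _ _ eq in f-injective (cong₂ _,_ i≡i′ j≡j′)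

module Representatives {n} {P : Pred (Fin n) 0ℓ} (P? : ∀ x → Dec (P x))
  {_≈_ : Rel (Fin n) 0ℓ} (_≈?_ : Decidable _≈_) (≈-isEquivalence : IsEquivalence _≈_) where

  open IsEquivalence ≈-isEquivalence renaming (refl to ≈-refl; sym to ≈-sym; trans to ≈-trans)

  IsMinimal : Pred (Fin n) 0ℓ
  IsMinimal r = P r × (∀ c → P c → c ≈ r → toℕ r ≤ toℕ c)

  isMinimal? : ∀ r → Dec (IsMinimal r)
  isMinimal? r = P? r ×-dec all? (λ c → P? c →-dec (c ≈? r →-dec r ≤? c))

  minimals : Subset n
  minimals = subset isMinimal?

  count : ℕ
  count = ∣ minimals ∣

  rep : Fin count → Fin n
  rep = enum minimals

  rep-minimal : ∀ j → IsMinimal (rep j)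
  rep-minimal j = ∈-subset⁻ isMinimal? (enum-∈ minimals j)

  rep∈P : ∀ j → P (rep j)
  rep∈P j = proj₁ (rep-minimal j)

  minimal-exists : ∀ {a} → P a → ∃ λ r → IsMinimal r × a ≈ r
  minimal-exists {a} pa
    with r , ¬¬[r∼a] , earlier ← ¬∀⟶∃¬-smallest n (λ c → ¬ (P c × c ≈ a))
                                   (λ c → ¬? (P? c ×-dec c ≈? a)) (λ none → none a (pa , ≈-refl))
    with pr , r≈a ← decidable-stable (P? r ×-dec r ≈? a) ¬¬[r∼a]
    = r , (pr , λ c pc c≈r → ℕₚ.≮⇒≥ λ c<r →
             earlier (fromℕ< c<r) (subst (λ d → P d × d ≈ a) (sym (inject-fromℕ< c<r)) (pc , ≈-trans c≈r r≈a)))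
        , ≈-sym r≈a
    where
    inject-fromℕ< : ∀ {c} (c<r : toℕ c ℕ.< toℕ r) → inject (fromℕ< c<r) ≡ c
    inject-fromℕ< c<r = toℕ-injective (trans (toℕ-inject _) (toℕ-fromℕ< c<r))

  rep-cover : ∀ {a} → P a → ∃ λ j → a ≈ rep j
  rep-cover {a} pa with r , r-minimal , a≈r ← minimal-exists pa =
    index minimals r∈ , subst (a ≈_) (sym (enum-index minimals r∈)) a≈r
    where r∈ = ∈-subset⁺ isMinimal? r-minimal

  rep-injective : ∀ {j j′} → rep j ≈ rep j′ → j ≡ j′
  rep-injective {j} {j′} eq = enum-injective minimals (≤-antisym
    (proj₂ (rep-minimal j) (rep j′) (rep∈P j′) (≈-sym eq))
    (proj₂ (rep-minimal j′) (rep j) (rep∈P j) eq))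

module Cyclic (m : ℕ) .{{_ : NonZero m}} where

  OnDiagonal : Fin m → Fin m → Fin m → Set
  OnDiagonal δ i j = (toℕ i + toℕ j) % m ≡ toℕ δ

  onDiagonal? : ∀ δ i j → Dec (OnDiagonal δ i j)
  onDiagonal? δ i j = (toℕ i + toℕ j) % m ℕ.≟ toℕ δ

  %-+-cancel : ∀ {a} b c → a ℕ.< m → b + c ≡ m → ((a + b) % m + c) % m ≡ a
  %-+-cancel {a} b c a<m b+c≡m = begin
    ((a + b) % m + c) % m          ≡⟨ %-distribˡ-+ ((a + b) % m) c m ⟩
    ((a + b) % m % m + c % m) % m  ≡⟨ cong (λ z → (z + c % m) % m) (m%n%n≡m%n (a + b) m) ⟩
    ((a + b) % m + c % m) % m      ≡⟨ %-distribˡ-+ (a + b) c m ⟨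
    (a + b + c) % m                ≡⟨ cong (_% m) (trans (ℕₚ.+-assoc a b c) (cong (a +_) b+c≡m)) ⟩
    (a + m) % m                    ≡⟨ [m+n]%n≡m%n a m ⟩
    a % m                          ≡⟨ m<n⇒m%n≡m a<m ⟩
    a                              ∎
    where open ≡-Reasoning

  onDiagonal-column : ∀ δ j → ∃ λ i → OnDiagonal δ i j
  onDiagonal-column δ j =
    fromℕ< (m%n<n (toℕ δ + (m ∸ toℕ j)) m) ,
    trans (cong (λ a → (a + toℕ j) % m) (toℕ-fromℕ< (m%n<n _ m)))
          (%-+-cancel (m ∸ toℕ j) (toℕ j) (toℕ<n δ) (ℕₚ.m∸n+n≡m (ℕₚ.<⇒≤ (toℕ<n j))))

  onDiagonal-injective : ∀ {δ i i′ j} → OnDiagonal δ i j → OnDiagonal δ i′ j → i ≡ i′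
  onDiagonal-injective {δ} {i} {i′} {j} d d′ = toℕ-injective (begin
    toℕ i                                    ≡⟨ %-+-cancel (toℕ j) (m ∸ toℕ j) (toℕ<n i) j+[m∸j]≡m ⟨
    ((toℕ i + toℕ j) % m + (m ∸ toℕ j)) % m  ≡⟨ cong (λ a → (a + (m ∸ toℕ j)) % m) (trans d (sym d′)) ⟩
    ((toℕ i′ + toℕ j) % m + (m ∸ toℕ j)) % m ≡⟨ %-+-cancel (toℕ j) (m ∸ toℕ j) (toℕ<n i′) j+[m∸j]≡m ⟩
    toℕ i′                                   ∎)
    where
    open ≡-Reasoning
    j+[m∸j]≡m : toℕ j + (m ∸ toℕ j) ≡ m
    j+[m∸j]≡m = ℕₚ.m+[n∸m]≡n (ℕₚ.<⇒≤ (toℕ<n j))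

  onDiagonal-sym : ∀ {δ i j} → OnDiagonal δ i j → OnDiagonal δ j i
  onDiagonal-sym {i = i} {j} d = trans (cong (_% m) (ℕₚ.+-comm (toℕ j) (toℕ i))) d

module _ {N : ℕ} (G : FinGroup N) where
  open FinGroup G

  group : Group 0ℓ 0ℓ
  group = record { isGroup = isGroup }

  -- Left cosets of H are the right cosets of H in the opposite group, so every statement about
  -- right cosets below also yields its left-coset counterpart.
  opposite : FinGroup N
  opposite = record { _∙_ = flip _∙_ ; ε = ε ; _⁻¹ = _⁻¹ ; isGroup = Flip.isGroup isGroup }

  opposite-subgroup : ∀ {H} → IsSubgroup G H → IsSubgroup opposite H
  opposite-subgroup sg = record
    { ε∈H = ε∈H ; ∙-closed = λ a∈H b∈H → ∙-closed b∈H a∈H ; ⁻¹-closed = ⁻¹-closed }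
    where open IsSubgroup sg

module FinGroupProperties {N : ℕ} (G : FinGroup N) where
  open FinGroup G public
  open IsGroup isGroup public using (assoc; identityˡ; identityʳ; _//_; _\\_)
  open GroupProperties (group G) public

module Cosets {N : ℕ} (G : FinGroup N) {H : Subset N} (sg : IsSubgroup G H) where
  open FinGroupProperties G
  open IsSubgroup sg

  SameRightCoset : Rel (Fin N) 0ℓ
  SameRightCoset y z = InRightCoset G H z y

  sameRightCoset? : Decidable SameRightCoset
  sameRightCoset? y z = any? λ h → (h ∈? H) ×-dec (y ≟ h ∙ z)

  coset-refl : ∀ {y} → SameRightCoset y y
  coset-refl {y} = ε , ε∈H , sym (identityˡ y)

  coset-sym : ∀ {y z} → SameRightCoset y z → SameRightCoset z y
  coset-sym {y} {z} (h , h∈H , y≡hz) = h ⁻¹ , ⁻¹-closed h∈H , y≈x\\z h z y (sym y≡hz)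

  coset-trans : ∀ {y z w} → SameRightCoset y z → SameRightCoset z w → SameRightCoset y w
  coset-trans {w = w} (h , h∈H , y≡hz) (h′ , h′∈H , z≡h′w) =
    h ∙ h′ , ∙-closed h∈H h′∈H , trans y≡hz (trans (cong (h ∙_) z≡h′w) (sym (assoc h h′ w)))

  coset-∙ʳ : ∀ {y z} g → SameRightCoset y z → SameRightCoset (y ∙ g) (z ∙ g)
  coset-∙ʳ {z = z} g (h , h∈H , y≡hz) = h , h∈H , trans (cong (_∙ g) y≡hz) (assoc h z g)

  sameRightCoset-isEquivalence : IsEquivalence SameRightCoset
  sameRightCoset-isEquivalence = record { refl = coset-refl ; sym = coset-sym ; trans = coset-trans }

  sameRightCoset-setoid : Setoid 0ℓ 0ℓ
  sameRightCoset-setoid = record { isEquivalence = sameRightCoset-isEquivalence }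

  module CosetReasoning = SetoidReasoning sameRightCoset-setoid

  record RightCosetDecomposition (K : Fin N → Set) (m : ℕ) : Set where
    field
      rep          : Fin m → Fin N
      rep-cover    : ∀ {y} → K y → ∃ λ j → SameRightCoset y (rep j)
      rep-distinct : ∀ {j j′} → SameRightCoset (rep j) (rep j′) → j ≡ j′

  decomposition-⊆ : ∀ {K K′ m} → (∀ {y} → K′ y → K y) →
                    RightCosetDecomposition K m → RightCosetDecomposition K′ m
  decomposition-⊆ K′⊆K D = record
    { rep = rep ; rep-cover = rep-cover ∘ K′⊆K ; rep-distinct = rep-distinct }
    where open RightCosetDecomposition D

  decomposition-cast : ∀ {K m m′} → m ≡ m′ →
                       RightCosetDecomposition K m → RightCosetDecomposition K m′
  decomposition-cast m≡m′ D = record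
    { rep          = rep ∘ cast (sym m≡m′)
    ; rep-cover    = λ y∈K → let j , y∼rep = rep-cover y∈K in
        cast m≡m′ j , subst (SameRightCoset _ ∘ rep) (sym (cast-involutive (sym m≡m′) m≡m′ j)) y∼rep
    ; rep-distinct = λ {j} {j′} rep∼rep′ → trans (sym (cast-involutive m≡m′ (sym m≡m′) j))
        (trans (cong (cast m≡m′) (rep-distinct rep∼rep′)) (cast-involutive m≡m′ (sym m≡m′) j′))
    }
    where open RightCosetDecomposition D

  latin-transversal :
    ∀ {K m} {I : Set} {S : I → Fin m → Set} {T : Subset N}
    (D : RightCosetDecomposition K m) (cell : I → Fin m → Fin N) →
    let open RightCosetDecomposition D in
    (∀ {t} → t ∈ T → ∃₂ λ i j → S i j × t ≡ cell i j) →
    (∀ {i j} → S i j → cell i j ∈ T) →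
    (∀ i j → K (cell i j)) →
    (∀ i j → SameRightCoset (cell i j) (rep j)) →
    (∀ j → ∃ λ i → S i j) →
    (∀ {i i′ j} → S i j → S i′ j → i ≡ i′) →
    IsRightTransversal G H K T
  latin-transversal {K} {T = T} D cell T⇒cell cell⇒T cell∈K cell∼rep S-total S-functional = record
    { T⊆K    = T⊆K
    ; covers = covers
    ; unique = unique
    }
    where
    open RightCosetDecomposition D
    open CosetReasoning

    T⊆K : ∀ {t} → t ∈ T → K t
    T⊆K t∈T with i , j , _ , refl ← T⇒cell t∈T = cell∈K i j

    covers : ∀ {y} → K y → ∃ λ t → t ∈ T × SameRightCoset t y
    covers y∈K with j , y∼rep ← rep-cover y∈K with i , s ← S-total j =
      cell i j , cell⇒T s , coset-trans (cell∼rep i j) (coset-sym y∼rep)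

    unique : ∀ {t t′} → t ∈ T → t′ ∈ T → SameRightCoset t′ t → t ≡ t′
    unique t∈T t′∈T t′∼t
      with i , j , s , refl ← T⇒cell t∈T | i′ , j′ , s′ , refl ← T⇒cell t′∈T
      with refl ← rep-distinct (begin
                    rep j        ≈⟨ cell∼rep i j ⟨
                    cell i j     ≈⟨ t′∼t ⟨
                    cell i′ j′   ≈⟨ cell∼rep i′ j′ ⟩
                    rep j′       ∎)
      = cong (λ i → cell i j) (S-functional s s′)

module Lagrange {N : ℕ} (G : FinGroup N) {H K : Subset N}
  (H-subgroup : IsSubgroup G H) (K-subgroup : IsSubgroup G K) (K⊆H : K ⊆ H) where
  open FinGroupProperties G
  open IsSubgroup H-subgroup
  open Cosets G K-subgroup using (SameRightCoset; sameRightCoset?; sameRightCoset-isEquivalence)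
  open Representatives (_∈? H) sameRightCoset? sameRightCoset-isEquivalence public

  factor : Fin count → Fin ∣ K ∣ → Fin N
  factor j r = enum K r ∙ rep j

  factor-sameCoset : ∀ {j r j′ r′} → factor j r ≡ factor j′ r′ → SameRightCoset (rep j) (rep j′)
  factor-sameCoset {j} {r} {j′} {r′} eq =
    k ⁻¹ ∙ k′ ,
    IsSubgroup.∙-closed K-subgroup (IsSubgroup.⁻¹-closed K-subgroup (enum-∈ K r)) (enum-∈ K r′) ,
    trans (y≈x\\z k (rep j) _ eq) (sym (assoc (k ⁻¹) k′ (rep j′)))
    where
    k k′ : Fin N
    k = enum K r
    k′ = enum K r′

  factor-injective : ∀ {j r j′ r′} → factor j r ≡ factor j′ r′ → j ≡ j′ × r ≡ r′
  factor-injective {j} eq with refl ← rep-injective (factor-sameCoset eq) =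
    refl , enum-injective K (∙-cancelʳ (rep j) _ _ eq)

  factorise : ∀ {h} → h ∈ H → ∃₂ λ j r → h ≡ factor j r
  factorise {h} h∈H with j , k , k∈K , h≡k∙rep ← rep-cover h∈H =
    j , index K k∈K , trans h≡k∙rep (cong (_∙ rep j) (sym (enum-index K k∈K)))

  lagrange : count * ∣ K ∣ ≡ ∣ H ∣
  lagrange = ℕₚ.≤-antisym
    (pairs-injective⇒≤ (λ j r → index H (factor∈H j r)) λ eq →
      factor-injective (trans (sym (enum-index H _)) (trans (cong (enum H) eq) (enum-index H _))))
    (injective⇒≤-pairs coordinates λ {s} {s′} eq → enum-injective H (begin
      enum H s                        ≡⟨ proj₂ (proj₂ (factorise (enum-∈ H s))) ⟩
      uncurry factor (coordinates s)  ≡⟨ cong (uncurry factor) eq ⟩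
      uncurry factor (coordinates s′) ≡⟨ proj₂ (proj₂ (factorise (enum-∈ H s′))) ⟨
      enum H s′                       ∎))
    where
    open ≡-Reasoning

    factor∈H : ∀ j r → factor j r ∈ H
    factor∈H j r = ∙-closed (K⊆H (enum-∈ K r)) (rep∈P j)

    coordinates : Fin ∣ H ∣ → Fin count × Fin ∣ K ∣
    coordinates s = let j , r , _ = factorise (enum-∈ H s) in j , r

module DoubleCosetDecomposition {N : ℕ} (G : FinGroup N) {H : Subset N} (sg : IsSubgroup G H) (x : Fin N) where
  open FinGroupProperties G
  open IsSubgroup sg
  open Cosets G sg

  InStabilizer : Pred (Fin N) 0ℓ
  InStabilizer k = k ∈ H × SameRightCoset (x ∙ k) x

  inStabilizer? : ∀ k → Dec (InStabilizer k)
  inStabilizer? k = (k ∈? H) ×-dec sameRightCoset? (x ∙ k) x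

  stabilizer : Subset N
  stabilizer = subset inStabilizer?

  stabilizer-subgroup : IsSubgroup G stabilizer
  stabilizer-subgroup = record
    { ε∈H       = ∈-subset⁺ inStabilizer? (ε∈H , subst (λ y → SameRightCoset y x) (sym (identityʳ x)) coset-refl)
    ; ∙-closed  = λ a∈ b∈ →
        ∈-subset⁺ inStabilizer? (∙-closed-stabilizer (∈-subset⁻ inStabilizer? a∈) (∈-subset⁻ inStabilizer? b∈))
    ; ⁻¹-closed = λ a∈ → ∈-subset⁺ inStabilizer? (⁻¹-closed-stabilizer (∈-subset⁻ inStabilizer? a∈))
    }
    where
    open CosetReasoning

    ∙-closed-stabilizer : ∀ {a b} → InStabilizer a → InStabilizer b → InStabilizer (a ∙ b)
    ∙-closed-stabilizer {a} {b} (a∈H , xa∼x) (b∈H , xb∼x) = ∙-closed a∈H b∈H , (begin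
      x ∙ (a ∙ b)  ≡⟨ assoc x a b ⟨
      x ∙ a ∙ b    ≈⟨ coset-∙ʳ b xa∼x ⟩
      x ∙ b        ≈⟨ xb∼x ⟩
      x            ∎)

    ⁻¹-closed-stabilizer : ∀ {a} → InStabilizer a → InStabilizer (a ⁻¹)
    ⁻¹-closed-stabilizer {a} (a∈H , xa∼x) = ⁻¹-closed a∈H , (begin
      x ∙ a ⁻¹      ≈⟨ coset-∙ʳ (a ⁻¹) xa∼x ⟨
      x ∙ a ∙ a ⁻¹  ≡⟨ //-rightDividesʳ a x ⟩
      x             ∎)

  open Lagrange G sg stabilizer-subgroup (proj₁ ∘ ∈-subset⁻ inStabilizer?) public

  decomposition : RightCosetDecomposition (DoubleCoset G H x) count
  decomposition = record
    { rep          = λ j → x ∙ rep j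
    ; rep-cover    = cover
    ; rep-distinct = distinct
    }
    where
    open CosetReasoning

    cover : ∀ {y} → DoubleCoset G H x y → ∃ λ j → SameRightCoset y (x ∙ rep j)
    cover {y} (h , h′ , h∈H , h′∈H , y≡hxh′) =
      let j , k , k∈ , h′≡k∙rep = rep-cover h′∈H
          y∼xh′ : SameRightCoset y (x ∙ h′)
          y∼xh′ = h , h∈H , trans y≡hxh′ (assoc h x h′)
      in j , (begin
        y                ≈⟨ y∼xh′ ⟩
        x ∙ h′           ≡⟨ cong (x ∙_) h′≡k∙rep ⟩
        x ∙ (k ∙ rep j)  ≡⟨ assoc x k (rep j) ⟨
        x ∙ k ∙ rep j    ≈⟨ coset-∙ʳ (rep j) (proj₂ (∈-subset⁻ inStabilizer? k∈)) ⟩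
        x ∙ rep j        ∎)

    distinct : ∀ {j j′} → SameRightCoset (x ∙ rep j) (x ∙ rep j′) → j ≡ j′
    distinct {j} {j′} xv∼xv′ = rep-injective
      (v // v′ , ∈-subset⁺ inStabilizer? (∙-closed (rep∈P j) (⁻¹-closed (rep∈P j′)) , x[v//v′]∼x) ,
       sym (//-rightDividesˡ v′ v))
      where
      v v′ : Fin N
      v = rep j
      v′ = rep j′

      x[v//v′]∼x : SameRightCoset (x ∙ (v // v′)) x
      x[v//v′]∼x = begin
        x ∙ (v // v′)   ≡⟨ assoc x v (v′ ⁻¹) ⟨
        x ∙ v ∙ v′ ⁻¹   ≈⟨ coset-∙ʳ (v′ ⁻¹) xv∼xv′ ⟩
        x ∙ v′ ∙ v′ ⁻¹  ≡⟨ //-rightDividesʳ v′ x ⟩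
        x               ∎

module CommonTransversals {N : ℕ} (G : FinGroup N) {H : Subset N} (sg : IsSubgroup G H) (x : Fin N) where
  open FinGroupProperties G
  open IsSubgroup sg
  open Cosets G sg
  private
    module R  = DoubleCosetDecomposition G sg x
    module L  = DoubleCosetDecomposition (opposite G) (opposite-subgroup G sg) x
    module Op = Cosets (opposite G) (opposite-subgroup G sg)

  E : Pred (Fin N) 0ℓ
  E = DoubleCoset G H x

  K : Subset N
  K = L.stabilizer

  m : ℕ
  m = L.count

  ∣stabilizer∣≡∣K∣ : ∣ R.stabilizer ∣ ≡ ∣ K ∣
  ∣stabilizer∣≡∣K∣ = ∣∣-≡-bijection (λ k → (x ∙ k) // x) (λ k → x \\ (k ∙ x))
    (λ k → trans (cong (x \\_) (//-rightDividesˡ x (x ∙ k))) (\\-leftDividesʳ x k))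
    (λ k → trans (cong (_// x) (\\-leftDividesˡ x (k ∙ x))) (//-rightDividesʳ x k))
    (λ {k} k∈ → let k∈H , h , h∈H , xk≡hx = ∈-subset⁻ R.inStabilizer? k∈ in
      ∈-subset⁺ L.inStabilizer? (subst (_∈ H) (sym (trans (cong (_// x) xk≡hx) (//-rightDividesʳ x h))) h∈H ,
                                 k , k∈H , //-rightDividesˡ x (x ∙ k)))
    (λ {k} k∈ → let k∈H , h , h∈H , kx≡xh = ∈-subset⁻ L.inStabilizer? k∈ in
      ∈-subset⁺ R.inStabilizer? (subst (_∈ H) (sym (trans (cong (x \\_) kx≡xh) (\\-leftDividesʳ x h))) h∈H ,
                                 k , k∈H , \\-leftDividesˡ x (k ∙ x)))

  count≡m : R.count ≡ m
  count≡m = ℕₚ.*-cancelʳ-≡ R.count m ∣ K ∣ {{nonZeroIndex (index K (IsSubgroup.ε∈H L.stabilizer-subgroup))}}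
    (trans (cong (R.count *_) (sym ∣stabilizer∣≡∣K∣)) (trans R.lagrange (sym L.lagrange)))

  instance
    m-nonZero : NonZero m
    m-nonZero = nonZeroIndex (proj₁ (L.rep-cover ε∈H))

  rightCosets : RightCosetDecomposition E m
  rightCosets = decomposition-cast count≡m R.decomposition

  leftCosets : Op.RightCosetDecomposition E m
  leftCosets = Op.decomposition-⊆ doubleCoset-opposite L.decomposition
    where
    doubleCoset-opposite : ∀ {y} → E y → DoubleCoset (opposite G) H x y
    doubleCoset-opposite (h , h′ , h∈H , h′∈H , y≡hxh′) = h′ , h , h′∈H , h∈H , trans y≡hxh′ (assoc h x h′)

  module RightCosets = RightCosetDecomposition rightCosets
  module LeftCosets  = Op.RightCosetDecomposition leftCosets

  u v : Fin m → Fin N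
  u = L.rep
  v j = R.rep (cast (sym count≡m) j)

  v∈H : ∀ j → v j ∈ H
  v∈H j = R.rep∈P (cast (sym count≡m) j)

  cell : Fin ∣ K ∣ → Fin m → Fin m → Fin N
  cell r i j = u i ∙ enum K r ∙ (x ∙ v j)

  ∈K⇒∈H : ∀ r → enum K r ∈ H
  ∈K⇒∈H r = proj₁ (∈-subset⁻ L.inStabilizer? (enum-∈ K r))

  cell∈E : ∀ r i j → E (cell r i j)
  cell∈E r i j =
    u i ∙ enum K r , v j , ∙-closed (L.rep∈P i) (∈K⇒∈H r) , v∈H j , sym (assoc (u i ∙ enum K r) x (v j))

  cell∼right : ∀ r i j → SameRightCoset (cell r i j) (RightCosets.rep j)
  cell∼right r i j = u i ∙ enum K r , ∙-closed (L.rep∈P i) (∈K⇒∈H r) , refl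

  cell∼left : ∀ r i j → Op.SameRightCoset (cell r i j) (LeftCosets.rep i)
  cell∼left r i j = Op.coset-trans
    (v j , v∈H j , trans (sym (assoc (u i ∙ enum K r) x (v j))) (cong (_∙ v j) (assoc (u i) (enum K r) x)))
    (Op.coset-∙ʳ (u i) (proj₂ (∈-subset⁻ L.inStabilizer? (enum-∈ K r))))

  cell-column : ∀ {r i j r′ i′ j′} → cell r i j ≡ cell r′ i′ j′ → j ≡ j′
  cell-column {r} {i} {j} {r′} {i′} {j′} eq = RightCosets.rep-distinct (begin
    x ∙ v j          ≈⟨ cell∼right r i j ⟨
    cell r i j       ≡⟨ eq ⟩
    cell r′ i′ j′    ≈⟨ cell∼right r′ i′ j′ ⟩
    x ∙ v j′         ∎)
    where open CosetReasoning

  cell-row : ∀ {r i j r′ i′ j′} → cell r i j ≡ cell r′ i′ j′ → i ≡ i′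
  cell-row {r} {i} {j} {r′} {i′} {j′} eq = LeftCosets.rep-distinct (begin
    u i ∙ x          ≈⟨ cell∼left r i j ⟨
    cell r i j       ≡⟨ eq ⟩
    cell r′ i′ j′    ≈⟨ cell∼left r′ i′ j′ ⟩
    u i′ ∙ x         ∎)
    where open Op.CosetReasoning

  cell-injective : ∀ {r i j r′ i′ j′} → cell r i j ≡ cell r′ i′ j′ → r ≡ r′ × i ≡ i′ × j ≡ j′
  cell-injective {r} {i} {j} {r′} {i′} {j′} eq = enum-injective K k≡k′ , cell-row eq , cell-column eq
    where
    k≡k′ : enum K r ≡ enum K r′
    k≡k′ = ∙-cancelˡ (u i) (enum K r) (enum K r′) (∙-cancelʳ (x ∙ v j) (u i ∙ enum K r) (u i ∙ enum K r′)
      (trans eq (cong₂ (cell r′) (sym (cell-row eq)) (sym (cell-column eq)))))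

  open Cyclic m

  OnDiagonalCell : Fin m → Fin ∣ K ∣ → Pred (Fin N) 0ℓ
  OnDiagonalCell δ r g = ∃₂ λ i j → OnDiagonal δ i j × g ≡ cell r i j

  onDiagonalCell? : ∀ δ r g → Dec (OnDiagonalCell δ r g)
  onDiagonalCell? δ r g = any? λ i → any? λ j → onDiagonal? δ i j ×-dec g ≟ cell r i j

  diagonal : Fin m → Fin ∣ K ∣ → Subset N
  diagonal δ r = subset (onDiagonalCell? δ r)

  ∈-diagonal⁺ : ∀ {δ r g} → OnDiagonalCell δ r g → g ∈ diagonal δ r
  ∈-diagonal⁺ {δ} {r} = ∈-subset⁺ (onDiagonalCell? δ r)

  ∈-diagonal⁻ : ∀ {δ r g} → g ∈ diagonal δ r → OnDiagonalCell δ r g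
  ∈-diagonal⁻ {δ} {r} = ∈-subset⁻ (onDiagonalCell? δ r)

  diagonal-rightTransversal : ∀ δ r → IsRightTransversal G H E (diagonal δ r)
  diagonal-rightTransversal δ r = latin-transversal rightCosets (cell r)
    ∈-diagonal⁻ (λ {i} {j} d → ∈-diagonal⁺ (i , j , d , refl))
    (cell∈E r) (cell∼right r) (onDiagonal-column δ) onDiagonal-injective

  diagonal-leftTransversal : ∀ δ r → IsRightTransversal (opposite G) H E (diagonal δ r)
  diagonal-leftTransversal δ r = Op.latin-transversal leftCosets (λ j i → cell r i j)
    (λ t∈ → let i , j , d , t≡ = ∈-diagonal⁻ t∈ in j , i , d , t≡)
    (λ {j} {i} d → ∈-diagonal⁺ (i , j , d , refl))
    (λ j i → cell∈E r i j) (λ j i → cell∼left r i j)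
    (λ i → let j , d = onDiagonal-column δ i in j , onDiagonal-sym {δ} {j} {i} d)
    (λ {j} {j′} {i} d d′ → onDiagonal-injective (onDiagonal-sym {δ} {i} {j} d) (onDiagonal-sym {δ} {i} {j′} d′))

  diagonal-disjoint : ∀ {δ r δ′ r′ g} → g ∈ diagonal δ r → g ∈ diagonal δ′ r′ → (δ , r) ≡ (δ′ , r′)
  diagonal-disjoint g∈ g∈′ =
    let i , j , d , g≡cell = ∈-diagonal⁻ g∈
        i′ , j′ , d′ , g≡cell′ = ∈-diagonal⁻ g∈′
        r≡r′ , i≡i′ , j≡j′ = cell-injective (trans (sym g≡cell) g≡cell′)
    in cong₂ _,_
         (toℕ-injective (trans (sym d) (trans (cong₂ (λ i j → (toℕ i + toℕ j) % m) i≡i′ j≡j′) d′)))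
         r≡r′

  label : Fin ∣ H ∣ → Fin m × Fin ∣ K ∣
  label q = remQuot ∣ K ∣ (cast (sym L.lagrange) q)

  label-injective : ∀ {q q′} → label q ≡ label q′ → q ≡ q′
  label-injective {q} {q′} eq = trans (sym (cast-involutive L.lagrange (sym L.lagrange) q))
    (trans (cong (cast L.lagrange) (remQuot-injective ∣ K ∣ eq)) (cast-involutive L.lagrange (sym L.lagrange) q′))

commonTransversals : ∀ {N} (G : FinGroup N) {H} → IsSubgroup G H → ∀ x →
  ∃ λ (A : Fin ∣ H ∣ → Subset N) →
    (∀ q → IsRightTransversal G H (DoubleCoset G H x) (A q)) ×
    (∀ q → IsRightTransversal (opposite G) H (DoubleCoset G H x) (A q)) ×
    (∀ q q′ → q ≢ q′ → Empty (A q ∩ A q′))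
commonTransversals {N} G {H} sg x =
  A ,
  (λ q → diagonal-rightTransversal (proj₁ (label q)) (proj₂ (label q))) ,
  (λ q → diagonal-leftTransversal (proj₁ (label q)) (proj₂ (label q))) ,
  λ q q′ q≢q′ (g , g∈) → let g∈A , g∈A′ = x∈p∩q⁻ (A q) (A q′) g∈ in
    q≢q′ (label-injective (diagonal-disjoint g∈A g∈A′))
  where
  open CommonTransversals G sg x

  A : Fin ∣ H ∣ → Subset N
  A q = uncurry diagonal (label q)

module DoubleCosets {N : ℕ} (G : FinGroup N) {H : Subset N} (sg : IsSubgroup G H) where
  open FinGroupProperties G
  open IsSubgroup sg
  open Cosets G sg

  doubleCoset-sym : ∀ {x y} → DoubleCoset G H x y → DoubleCoset G H y x
  doubleCoset-sym {x} {y} (h , h′ , h∈H , h′∈H , y≡hxh′) =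
    h ⁻¹ , h′ ⁻¹ , ⁻¹-closed h∈H , ⁻¹-closed h′∈H ,
    trans (y≈x\\z h x (y // h′) (x≈z//y (h ∙ x) h′ y (sym y≡hxh′))) (sym (assoc (h ⁻¹) y (h′ ⁻¹)))

  doubleCoset-trans : ∀ {x y z} → DoubleCoset G H x y → DoubleCoset G H y z → DoubleCoset G H x z
  doubleCoset-trans {x} {y} {z} (h , h′ , h∈H , h′∈H , y≡hxh′) (a , b , a∈H , b∈H , z≡ayb) =
    a ∙ h , h′ ∙ b , ∙-closed a∈H h∈H , ∙-closed h′∈H b∈H , (begin
      z                    ≡⟨ z≡ayb ⟩
      a ∙ y ∙ b            ≡⟨ cong (λ w → a ∙ w ∙ b) y≡hxh′ ⟩
      a ∙ (h ∙ x ∙ h′) ∙ b ≡⟨ cong (_∙ b) (assoc a (h ∙ x) h′) ⟨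
      a ∙ (h ∙ x) ∙ h′ ∙ b ≡⟨ cong (λ w → w ∙ h′ ∙ b) (assoc a h x) ⟨
      a ∙ h ∙ x ∙ h′ ∙ b   ≡⟨ assoc (a ∙ h ∙ x) h′ b ⟩
      a ∙ h ∙ x ∙ (h′ ∙ b) ∎)
    where open ≡-Reasoning

  doubleCoset-⁻¹ : ∀ {x y} → DoubleCoset G H x y → DoubleCoset G H (x ⁻¹) (y ⁻¹)
  doubleCoset-⁻¹ {x} {y} (h , h′ , h∈H , h′∈H , y≡hxh′) =
    h′ ⁻¹ , h ⁻¹ , ⁻¹-closed h′∈H , ⁻¹-closed h∈H , (begin
      y ⁻¹                      ≡⟨ cong _⁻¹ y≡hxh′ ⟩
      (h ∙ x ∙ h′) ⁻¹           ≡⟨ ⁻¹-anti-homo-∙ (h ∙ x) h′ ⟩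
      h′ ⁻¹ ∙ (h ∙ x) ⁻¹        ≡⟨ cong (h′ ⁻¹ ∙_) (⁻¹-anti-homo-∙ h x) ⟩
      h′ ⁻¹ ∙ (x ⁻¹ ∙ h ⁻¹)     ≡⟨ assoc (h′ ⁻¹) (x ⁻¹) (h ⁻¹) ⟨
      h′ ⁻¹ ∙ x ⁻¹ ∙ h ⁻¹       ∎)
    where open ≡-Reasoning

  coset⇒doubleCoset : ∀ {y z} → SameRightCoset y z → DoubleCoset G H z y
  coset⇒doubleCoset {y} {z} (h , h∈H , y≡hz) = h , ε , h∈H , ε∈H , trans y≡hz (sym (identityʳ (h ∙ z)))

  doubleCoset-meet : ∀ {x y g} → DoubleCoset G H x g → DoubleCoset G H y g →
                     SameSet (DoubleCoset G H x) (DoubleCoset G H y)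
  doubleCoset-meet x∼g y∼g z = mk⇔
    (λ x∼z → doubleCoset-trans y∼g (doubleCoset-trans (doubleCoset-sym x∼g) x∼z))
    (λ y∼z → doubleCoset-trans x∼g (doubleCoset-trans (doubleCoset-sym y∼g) y∼z))

module Symmetrization {N : ℕ} (G : FinGroup N) {H : Subset N} (sg : IsSubgroup G H) (x : Fin N)
  (E∩E′=∅ : ∀ {g} → DoubleCoset G H x g → DoubleCoset G H (FinGroup._⁻¹ G x) g → ⊥) where
  open FinGroupProperties G
  open IsSubgroup sg
  open Cosets G sg
  open DoubleCosets G sg

  E E′ : Pred (Fin N) 0ℓ
  E = DoubleCoset G H x
  E′ = DoubleCoset G H (x ⁻¹)

  E′⇒E⁻¹ : ∀ {g} → E′ g → E (g ⁻¹)
  E′⇒E⁻¹ {g} e′ = subst (λ z → DoubleCoset G H z (g ⁻¹)) (⁻¹-involutive x) (doubleCoset-⁻¹ e′)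

  E⁻¹⇒E′ : ∀ {g} → E (g ⁻¹) → E′ g
  E⁻¹⇒E′ {g} e = subst E′ (⁻¹-involutive g) (doubleCoset-⁻¹ e)

  Symmetric : Subset N → Pred (Fin N) 0ℓ
  Symmetric A g = g ∈ A ⊎ g ⁻¹ ∈ A

  symmetric? : ∀ A g → Dec (Symmetric A g)
  symmetric? A g = (g ∈? A) ⊎-dec (g ⁻¹ ∈? A)

  symmetrize : Subset N → Subset N
  symmetrize A = subset (symmetric? A)

  symmetric-⁻¹ : ∀ {A g} → Symmetric A g → Symmetric A (g ⁻¹)
  symmetric-⁻¹ {A} {g} (inj₁ g∈A)   = inj₂ (subst (_∈ A) (sym (⁻¹-involutive g)) g∈A)
  symmetric-⁻¹         (inj₂ g⁻¹∈A) = inj₁ g⁻¹∈A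

  symmetrize-⁻¹ : ∀ {A g} → g ∈ symmetrize A → g ⁻¹ ∈ symmetrize A
  symmetrize-⁻¹ {A} = ∈-subset⁺ (symmetric? A) ∘ symmetric-⁻¹ ∘ ∈-subset⁻ (symmetric? A)

  symmetrize-rightTransversal : ∀ {A} →
    IsRightTransversal G H E A → IsRightTransversal (opposite G) H E A →
    IsRightTransversal G H (E ∪ₚ E′) (symmetrize A)
  symmetrize-rightTransversal {A} right left = record
    { T⊆K    = T⊆K ∘ ∈-subset⁻ (symmetric? A)
    ; covers = covers
    ; unique = λ t∈ t′∈ → unique (∈-subset⁻ (symmetric? A) t∈) (∈-subset⁻ (symmetric? A) t′∈)
    }
    where
    module R = IsRightTransversal right
    module L = IsRightTransversal left

    T⊆K : ∀ {t} → Symmetric A t → (E ∪ₚ E′) t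
    T⊆K (inj₁ t∈A)   = inj₁ (R.T⊆K t∈A)
    T⊆K (inj₂ t⁻¹∈A) = inj₂ (E⁻¹⇒E′ (R.T⊆K t⁻¹∈A))

    covers : ∀ {y} → (E ∪ₚ E′) y → ∃ λ t → t ∈ symmetrize A × SameRightCoset t y
    covers (inj₁ y∈E) with t , t∈A , t∼y ← R.covers y∈E = t , ∈-subset⁺ (symmetric? A) (inj₁ t∈A) , t∼y
    covers {y} (inj₂ y∈E′) with a , a∈A , h , h∈H , a≡y⁻¹h ← L.covers (E′⇒E⁻¹ y∈E′) =
      a ⁻¹ , ∈-subset⁺ (symmetric? A) (symmetric-⁻¹ (inj₁ a∈A)) , h ⁻¹ , ⁻¹-closed h∈H , (begin
        a ⁻¹               ≡⟨ cong _⁻¹ a≡y⁻¹h ⟩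
        (y ⁻¹ ∙ h) ⁻¹      ≡⟨ ⁻¹-anti-homo-∙ (y ⁻¹) h ⟩
        h ⁻¹ ∙ y ⁻¹ ⁻¹     ≡⟨ cong (h ⁻¹ ∙_) (⁻¹-involutive y) ⟩
        h ⁻¹ ∙ y           ∎)
      where open ≡-Reasoning

    unique : ∀ {t t′} → Symmetric A t → Symmetric A t′ → SameRightCoset t′ t → t ≡ t′
    unique (inj₁ t∈A) (inj₁ t′∈A) t′∼t = R.unique t∈A t′∈A t′∼t
    unique {t} {t′} (inj₂ t⁻¹∈A) (inj₂ t′⁻¹∈A) (h , h∈H , t′≡ht) =
      ⁻¹-injective (L.unique t⁻¹∈A t′⁻¹∈A
        (h ⁻¹ , ⁻¹-closed h∈H , trans (cong _⁻¹ t′≡ht) (⁻¹-anti-homo-∙ h t)))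
    unique (inj₁ t∈A) (inj₂ t′⁻¹∈A) t′∼t =
      ⊥-elim (E∩E′=∅ (doubleCoset-trans (R.T⊆K t∈A) (coset⇒doubleCoset t′∼t)) (E⁻¹⇒E′ (R.T⊆K t′⁻¹∈A)))
    unique (inj₂ t⁻¹∈A) (inj₁ t′∈A) t′∼t =
      ⊥-elim (E∩E′=∅ (doubleCoset-trans (R.T⊆K t′∈A) (coset⇒doubleCoset (coset-sym t′∼t)))
                     (E⁻¹⇒E′ (R.T⊆K t⁻¹∈A)))

  symmetrize-disjoint : ∀ {A B} → (∀ {a} → a ∈ A → E a) → (∀ {b} → b ∈ B → E b) →
                        Empty (A ∩ B) → Empty (symmetrize A ∩ symmetrize B)
  symmetrize-disjoint {A} {B} A⊆E B⊆E A∩B=∅ (g , g∈) =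
    let g∈A′ , g∈B′ = x∈p∩q⁻ (symmetrize A) (symmetrize B) g∈
    in disjoint (∈-subset⁻ (symmetric? A) g∈A′) (∈-subset⁻ (symmetric? B) g∈B′)
    where
    disjoint : Symmetric A g → Symmetric B g → ⊥
    disjoint (inj₁ g∈A)   (inj₁ g∈B)   = A∩B=∅ (g , x∈p∩q⁺ (g∈A , g∈B))
    disjoint (inj₂ g⁻¹∈A) (inj₂ g⁻¹∈B) = A∩B=∅ (g ⁻¹ , x∈p∩q⁺ (g⁻¹∈A , g⁻¹∈B))
    disjoint (inj₁ g∈A)   (inj₂ g⁻¹∈B) = E∩E′=∅ (A⊆E g∈A) (E⁻¹⇒E′ (B⊆E g⁻¹∈B))
    disjoint (inj₂ g⁻¹∈A) (inj₁ g∈B)   = E∩E′=∅ (B⊆E g∈B) (E⁻¹⇒E′ (A⊆E g⁻¹∈A))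

lemma4p1 : (p : ℕ) → Prime p → (G : FinGroup (4 * p)) →
    (H : Subset (4 * p)) → IsSubgroup G H → NontrivialSet G H →
    (x : Fin (4 * p)) →
    ¬ SameSet (DoubleCoset G H x) (DoubleCoset G H (FinGroup._⁻¹ G x)) →
    (b : ℕ) → b ≤ ∣ H ∣ →
    ∃ λ (T : Fin b → Subset (4 * p)) →
      (∀ i → IsRightTransversal G H
               (DoubleCoset G H x ∪ₚ DoubleCoset G H (FinGroup._⁻¹ G x)) (T i))
      × (∀ i j → i ≢ j → Empty (T i ∩ T j))
      × InverseClosed G (⋃ T)
lemma4p1 p _ G H sg _ x HxH≠Hx⁻¹H b b≤∣H∣ =
  T ,
  (λ i → symmetrize-rightTransversal (A-right (ι i)) (A-left (ι i))) ,
  (λ i j i≢j → symmetrize-disjoint (A⊆E (ι i)) (A⊆E (ι j))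
                 (A-disjoint (ι i) (ι j) (i≢j ∘ inject≤-injective b≤∣H∣ b≤∣H∣ i j))) ,
  λ g → mk⇔ (λ (i , g∈) → i , symmetrize-⁻¹ g∈)
            (λ (i , g⁻¹∈) → i , subst (_∈ T i) (⁻¹-involutive g) (symmetrize-⁻¹ g⁻¹∈))
  where
  open FinGroupProperties G using (⁻¹-involutive)
  open Symmetrization G sg x (λ e e′ → HxH≠Hx⁻¹H (DoubleCosets.doubleCoset-meet G sg e e′))

  A : Fin ∣ H ∣ → Subset (4 * p)
  A = proj₁ (commonTransversals G sg x)

  A-right : ∀ q → IsRightTransversal G H E (A q)
  A-right = proj₁ (proj₂ (commonTransversals G sg x))

  A-left : ∀ q → IsRightTransversal (opposite G) H E (A q)
  A-left = proj₁ (proj₂ (proj₂ (commonTransversals G sg x)))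

  A-disjoint : ∀ q q′ → q ≢ q′ → Empty (A q ∩ A q′)
  A-disjoint = proj₂ (proj₂ (proj₂ (commonTransversals G sg x)))

  A⊆E : ∀ q {a} → a ∈ A q → E a
  A⊆E q = IsRightTransversal.T⊆K (A-right q)

  ι : Fin b → Fin ∣ H ∣
  ι i = inject≤ i b≤∣H∣

  T : Fin b → Subset (4 * p)
  T i = symmetrize (A (ι i))
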